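{- Let $\mathscr{S}$ be the set of integer partitions $\mu_1+\cdots+\mu_s$ (empty partition included) with $\mu_i-\mu_{i+1}\ge 3$ for all $i$ and strict inequality whenever $3\mid\mu_i$, and let $$A_1(x)=\sum_{\lambda\in\mathscr{S}}x^{\sharp(\lambda)}y^{\sharp_{0,2}(\lambda)}q^{|\lambda|}.$$ Then \begin{align*} 0 &= \big[1+x (q^7+ yq^8)\big] A_1(x)\\ &\quad- \big[1 + x (q + q^3 + q^5 + q^7 + yq^2 + yq^4 + yq^6 + yq^8)\\ &\quad\quad+ x^2 (q^6 + q^8 + q^{10} + yq^5 + 2 yq^7 + 2 yq^9 + 2 yq^{11} + yq^{13} + y^2q^8 + y^2q^{10} + y^2q^{12})\\ &\quad\quad+ x^3 (yq^{12} + yq^{14} + y^2q^{13} + y^2q^{15})\big]A_1(xq^6)\\ &\quad+\big[x^2 yq^{15} +x^3 (-q^{21}+ yq^{16}+ y^2q^{17}- y^3q^{24})\\ &\quad\quad+x^4 (-q^{22}- yq^{23}+ y^2q^{30}- y^3q^{25}- y^4q^{26})+x^5 (y^2q^{31} + y^3q^{32})\big]A_1(xq^{12}). \end{align*}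
   Context: For a partition $\lambda$, $|\lambda|$ is the sum of its parts, $\sharp(\lambda)$ the number of parts, and $\sharp_{0,2}(\lambda)$ the number of even parts. -}

module Defs where

open import Data.Nat using (ℕ; zero; suc; _+_; _*_; _∸_; _≤?_; _≤ᵇ_; _≡ᵇ_; _%_)
open import Data.Nat.Divisibility using (_∣?_)
open import Data.Integer using (ℤ; +_; 0ℤ) renaming (_+_ to _+ℤ_; _*_ to _*ℤ_; _-_ to _-ℤ_)
open import Data.List using (List; []; _∷_; [_]; map; concatMap; filter; applyUpTo; length)
open import Data.Product using (_×_)
open import Data.Bool using (Bool; true; false; _∧_; if_then_else_; not; T?)
open import Relation.Nullary.Decidable using (does)

-- Integer partitions, represented as weakly decreasing lists of
-- positive parts (largest part first).

-- partitionsBounded f m n : all partitions of n with every part ≤ m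
-- (f is fuel; f = n suffices since each part is ≥ 1).
partitionsBounded : ℕ → ℕ → ℕ → List (List ℕ)
partitionsBounded _       _ zero    = [ [] ]
partitionsBounded zero    _ (suc _) = []
partitionsBounded (suc f) m (suc n) =
  concatMap (λ p → map (p ∷_) (partitionsBounded f p (suc n ∸ p)))
            (filter (λ p → p ≤? m) (applyUpTo suc (suc n)))

partitions : ℕ → List (List ℕ)
partitions n = partitionsBounded n n n

-- |λ| is n for λ ∈ partitions n; ♯(λ) = number of parts
♯ : List ℕ → ℕ
♯ = length

♯₀₂ : List ℕ → ℕ
♯₀₂ λs = length (filter (λ p → 2 ∣? p) λs)

gapOK : ℕ → ℕ → Bool
gapOK a b = if does (3 ∣? a) then (b + 4 ≤ᵇ a) else (b + 3 ≤ᵇ a)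

inS : List ℕ → Bool
inS (a ∷ b ∷ r) = gapOK a b ∧ inS (b ∷ r)
inS _           = true

-- Formal power series in x, y, q with integer coefficients,
-- represented by their coefficient function: F a b n = [x^a y^b q^n] F.

FPS : Set
FPS = ℕ → ℕ → ℕ → ℤ

countS : ℕ → ℕ → ℕ → ℕ
countS a b n =
  length (filter (λ l → T? (inS l ∧ (♯ l ≡ᵇ a) ∧ (♯₀₂ l ≡ᵇ b))) (partitions n))

A₁ : FPS
A₁ a b n = + countS a b n

Σ≤ : ℕ → (ℕ → ℤ) → ℤ
Σ≤ zero    f = f 0
Σ≤ (suc n) f = Σ≤ n f +ℤ f (suc n)

infixl 6 _⊕_ _⊖_
infixl 7 _⊛_

_⊕_ : FPS → FPS → FPS
(F ⊕ G) a b n = F a b n +ℤ G a b n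

_⊖_ : FPS → FPS → FPS
(F ⊖ G) a b n = F a b n -ℤ G a b n

_⊛_ : FPS → FPS → FPS
(F ⊛ G) a b n =
  Σ≤ a λ i → Σ≤ b λ j → Σ≤ n λ k →
    F i j k *ℤ G (a ∸ i) (b ∸ j) (n ∸ k)

mono : ℤ → ℕ → ℕ → ℕ → FPS
mono c i j k a b n =
  if (i ≡ᵇ a) ∧ (j ≡ᵇ b) ∧ (k ≡ᵇ n) then c else 0ℤ

substXq : ℕ → FPS → FPS
substXq k F a b n = if k * a ≤ᵇ n then F a b (n ∸ k * a) else 0ℤ

𝕞 : ℕ → ℕ → ℕ → FPS
𝕞 = mono (+ 1)

𝕞₂ : ℕ → ℕ → ℕ → FPS
𝕞₂ = mono (+ 2)

𝟘 : FPS
𝟘 _ _ _ = 0ℤ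

module Submission where

-- Let B_m be the generating function of the partitions in 𝒮 all of whose parts are at least m, so that
-- A₁ = B₁. Splitting off the smallest part gives the recurrence
--   B_m = B_{m+1} + x y^[2 ∣ m] q^m B_{m + g(m)},   g(m) = 4 if 3 ∣ m and 3 otherwise,
-- since the gap condition may be read off the smaller of two consecutive parts. Adding 6 to every part
-- preserves parities and residues mod 3, so B_{m+6}(x) = B_m(x q^6); hence A₁(x q^6) = B₇ and
-- A₁(x q^12) = B₁₃. The identity is then a combination, with monomial coefficients, of finitely many
-- instances of the recurrence (listed in certificate); checking that they add up to the identity is a
-- normalisation of linear forms in the symbols x^i y^j q^k B_m.

open import Defs
open import Data.Nat using (ℕ)
open import Data.Integer using (0ℤ)
open import Relation.Binary.PropositionalEquality using (_≡_)
open import Relation.Binary.Definitions using (DecidableEquality)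

module Arithmetic where

  open import Data.Nat using (ℕ; zero; suc; _+_; _∸_; _≤_; _<_; _⊓_; _≤ᵇ_; _≤?_; z≤n; s≤s)
  open import Data.Nat.Properties
  open import Data.Bool using (Bool; true; false; _∧_; if_then_else_; T)
  open import Data.Unit using (tt)
  open import Relation.Binary.PropositionalEquality
  open import Relation.Nullary.Decidable using (dec-true; dec-false; does-⇔)
  open import Function.Bundles using (mk⇔)
  open import Algebra.Properties.CommutativeSemigroup +-commutativeSemigroup using (interchange)

  ≤ᵇ-suc : ∀ m n → (suc m ≤ᵇ suc n) ≡ (m ≤ᵇ n)
  ≤ᵇ-suc zero    n = refl
  ≤ᵇ-suc (suc m) n = refl

  ≤⇒≤ᵇ≡true : ∀ {m n} → m ≤ n → (m ≤ᵇ n) ≡ true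
  ≤⇒≤ᵇ≡true {m} {n} = dec-true (m ≤? n)

  >⇒≤ᵇ≡false : ∀ {m n} → n < m → (m ≤ᵇ n) ≡ false
  >⇒≤ᵇ≡false {m} {n} n<m = dec-false (m ≤? n) (<⇒≱ n<m)

  ≤ᵇ≡true⇒≤ : ∀ m n → (m ≤ᵇ n) ≡ true → m ≤ n
  ≤ᵇ≡true⇒≤ m n e = ≤ᵇ⇒≤ m n (subst T (sym e) tt)

  ≤ᵇ-cong : ∀ {m n m' n'} → (m ≤ n → m' ≤ n') → (m' ≤ n' → m ≤ n) → (m ≤ᵇ n) ≡ (m' ≤ᵇ n')
  ≤ᵇ-cong {m} {n} {m'} {n'} f g = does-⇔ (mk⇔ f g) (m ≤? n) (m' ≤? n')

  ≤ᵇ-+ : ∀ x y n → ((x ≤ᵇ n) ∧ (y ≤ᵇ n ∸ x)) ≡ (x + y ≤ᵇ n)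
  ≤ᵇ-+ zero    y n       = refl
  ≤ᵇ-+ (suc x) y zero    = refl
  ≤ᵇ-+ (suc x) y (suc n) =
    trans (cong (_∧ (y ≤ᵇ n ∸ x)) (≤ᵇ-suc x n)) (trans (≤ᵇ-+ x y n) (sym (≤ᵇ-suc (x + y) n)))

  ≤ᵇ-∸ : ∀ q c p → (suc q ≤ᵇ p ∸ c) ≡ (suc q + c ≤ᵇ p)
  ≤ᵇ-∸ q zero    p       = cong (_≤ᵇ p) (sym (+-identityʳ (suc q)))
  ≤ᵇ-∸ q (suc c) zero    = refl
  ≤ᵇ-∸ q (suc c) (suc p) =
    trans (≤ᵇ-∸ q c p) (sym (trans (≤ᵇ-suc (q + suc c) p) (cong (_≤ᵇ p) (+-suc q c))))

  if-if-swap : ∀ (A K C : Bool) (v : ℕ) → (K ≡ true → C ≡ true → A ≡ true) →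
    (if A then (if K then (if C then v else 0) else 0) else 0) ≡ (if C then (if K then v else 0) else 0)
  if-if-swap true  true  true  v _ = refl
  if-if-swap true  true  false v _ = refl
  if-if-swap true  false true  v _ = refl
  if-if-swap true  false false v _ = refl
  if-if-swap false true  true  v K⇒C⇒A with K⇒C⇒A refl refl
  ... | ()
  if-if-swap false true  false v _ = refl
  if-if-swap false false true  v _ = refl
  if-if-swap false false false v _ = refl

  if-absorb : ∀ (A K : Bool) (v : ℕ) → (K ≡ true → A ≡ true) → (if A then (if K then v else 0) else 0) ≡ (if K then v else 0)
  if-absorb true  K     v _ = refl
  if-absorb false false v _ = refl
  if-absorb false true  v K⇒A with K⇒A refl
  ... | ()

  if-interchange : ∀ (A B C D : Bool) (v : ℕ) →
    (if A then (if B then (if C then (if D then v else 0) else 0) else 0) else 0)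
    ≡ (if A ∧ C then (if B ∧ D then v else 0) else 0)
  if-interchange false B     C     D     v = refl
  if-interchange true  false false D     v = refl
  if-interchange true  false true  false v = refl
  if-interchange true  false true  true  v = refl
  if-interchange true  true  C     D     v = refl

  guard-suc : ∀ i a (X Y : ℕ → ℕ) → X 0 ≡ 0 → (∀ a' → X (suc a') ≡ Y a') →
              (if i ≤ᵇ a then X (a ∸ i) else 0) ≡ (if suc i ≤ᵇ a then Y (a ∸ suc i) else 0)
  guard-suc zero    zero    X Y X0 Xs = X0
  guard-suc zero    (suc a) X Y X0 Xs = Xs a
  guard-suc (suc i) zero    X Y X0 Xs = refl
  guard-suc (suc i) (suc a) X Y X0 Xs = trans (cong (λ c → if c then X (a ∸ i) else 0) (≤ᵇ-suc i a)) (guard-suc i a X Y X0 Xs)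

  if-+ : ∀ (c : Bool) x y → (if c then x + y else 0) ≡ (if c then x else 0) + (if c then y else 0)
  if-+ true  x y = refl
  if-+ false x y = refl

  Σ< : ℕ → (ℕ → ℕ) → ℕ
  Σ< zero    f = 0
  Σ< (suc N) f = f 0 + Σ< N (λ i → f (suc i))

  Σ₁ : ℕ → (ℕ → ℕ) → ℕ
  Σ₁ N f = Σ< N (λ i → f (suc i))

  Σ<-cong : ∀ N {f g : ℕ → ℕ} → (∀ i → i < N → f i ≡ g i) → Σ< N f ≡ Σ< N g
  Σ<-cong zero    h = refl
  Σ<-cong (suc N) h = cong₂ _+_ (h 0 (s≤s z≤n)) (Σ<-cong N (λ i lt → h (suc i) (s≤s lt)))

  Σ<-zero : ∀ N {f : ℕ → ℕ} → (∀ i → f i ≡ 0) → Σ< N f ≡ 0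
  Σ<-zero zero    h = refl
  Σ<-zero (suc N) h rewrite h 0 = Σ<-zero N (λ i → h (suc i))

  Σ<-+ : ∀ N (f g : ℕ → ℕ) → Σ< N (λ i → f i + g i) ≡ Σ< N f + Σ< N g
  Σ<-+ zero    f g = refl
  Σ<-+ (suc N) f g rewrite Σ<-+ N (λ i → f (suc i)) (λ i → g (suc i)) = interchange (f 0) (g 0) _ _

  Σ<-swap : ∀ N M (f : ℕ → ℕ → ℕ) → Σ< N (λ i → Σ< M (f i)) ≡ Σ< M (λ j → Σ< N (λ i → f i j))
  Σ<-swap zero    M f = sym (Σ<-zero M (λ _ → refl))
  Σ<-swap (suc N) M f =
    trans (cong (Σ< M (f 0) +_) (Σ<-swap N M (λ i → f (suc i))))
          (sym (Σ<-+ M (f 0) (λ j → Σ< N (λ i → f (suc i) j))))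

  Σ<-split : ∀ N M (f : ℕ → ℕ) → Σ< (N + M) f ≡ Σ< N f + Σ< M (λ i → f (N + i))
  Σ<-split zero    M f = refl
  Σ<-split (suc N) M f rewrite Σ<-split N M (λ i → f (suc i)) = sym (+-assoc (f 0) _ _)

  Σ<-if : ∀ (c : Bool) N (f : ℕ → ℕ) → (if c then Σ< N f else 0) ≡ Σ< N (λ i → if c then f i else 0)
  Σ<-if true  N f = refl
  Σ<-if false N f = sym (Σ<-zero N (λ _ → refl))

  Σ<-⊓ : ∀ N M (f : ℕ → ℕ) → Σ< N (λ i → if suc i ≤ᵇ M then f i else 0) ≡ Σ< (N ⊓ M) f
  Σ<-⊓ zero    M       f = refl
  Σ<-⊓ (suc N) zero    f = Σ<-zero N (λ _ → refl)
  Σ<-⊓ (suc N) (suc M) f = cong (f 0 +_) (Σ<-⊓ N M (λ i → f (suc i)))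

  Σ₁-extend : ∀ M N (f : ℕ → ℕ) → M ≤ N → Σ₁ M f ≡ Σ₁ N (λ p → if p ≤ᵇ M then f p else 0)
  Σ₁-extend M N f M≤N = trans (cong (λ z → Σ< z (λ i → f (suc i))) (sym (m≥n⇒m⊓n≡n M≤N)))
                              (sym (Σ<-⊓ N M (λ i → f (suc i))))

  Σ₁-truncate : ∀ n u (F : ℕ → ℕ) → n ≤ u → (∀ p → n < p → F p ≡ 0) → Σ₁ u F ≡ Σ₁ n F
  Σ₁-truncate n u F n≤u vanish = begin
      Σ< u (λ i → F (suc i))
    ≡⟨ cong (λ z → Σ< z (λ i → F (suc i))) (sym (m+[n∸m]≡n n≤u)) ⟩
      Σ< (n + (u ∸ n)) (λ i → F (suc i))
    ≡⟨ Σ<-split n (u ∸ n) (λ i → F (suc i)) ⟩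
      Σ< n (λ i → F (suc i)) + Σ< (u ∸ n) (λ i → F (suc (n + i)))
    ≡⟨ cong (Σ< n (λ i → F (suc i)) +_) (Σ<-zero (u ∸ n) (λ i → vanish (suc (n + i)) (s≤s (m≤m+n n i)))) ⟩
      Σ< n (λ i → F (suc i)) + 0
    ≡⟨ +-identityʳ _ ⟩
      Σ< n (λ i → F (suc i))
    ∎
    where open ≡-Reasoning

  Σ₁-peel : ∀ u m (F : ℕ → ℕ) →
    Σ₁ u (λ p → if suc m ≤ᵇ p then F p else 0)
    ≡ Σ₁ u (λ p → if suc (suc m) ≤ᵇ p then F p else 0) + (if suc m ≤ᵇ u then F (suc m) else 0)
  Σ₁-peel zero    m       F = refl
  Σ₁-peel (suc u) zero    F = +-comm (F 1) _
  Σ₁-peel (suc u) (suc m) F = Σ₁-peel u m (λ p → F (suc p))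

  -- ℕ-valued series in y and q are coefficient functions b n ↦ [y^b q^n]
  infixr 7 y^_q^_·_

  y^_q^_·_ : ℕ → ℕ → (ℕ → ℕ → ℕ) → ℕ → ℕ → ℕ
  (y^ e q^ k · F) b n = if k ≤ᵇ n then (if e ≤ᵇ b then F (b ∸ e) (n ∸ k) else 0) else 0

  y^q^-cong : ∀ e k (F F' : ℕ → ℕ → ℕ) b n → (∀ b' → F b' (n ∸ k) ≡ F' b' (n ∸ k)) →
              (y^ e q^ k · F) b n ≡ (y^ e q^ k · F') b n
  y^q^-cong e k F F' b n h with k ≤ᵇ n | e ≤ᵇ b
  ... | true  | true  = h _
  ... | true  | false = refl
  ... | false | _     = refl

  y^q^-comp : ∀ e k e' k' F b n → (y^ e q^ k · y^ e' q^ k' · F) b n ≡ (y^ (e + e') q^ (k + k') · F) b n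
  y^q^-comp e k e' k' F b n
    rewrite if-interchange (k ≤ᵇ n) (e ≤ᵇ b) (k' ≤ᵇ n ∸ k) (e' ≤ᵇ b ∸ e) (F (b ∸ e ∸ e') (n ∸ k ∸ k'))
          | ≤ᵇ-+ k k' n | ≤ᵇ-+ e e' b | ∸-+-assoc b e e' | ∸-+-assoc n k k' = refl

  y^q^-Σ : ∀ e k N (F : ℕ → ℕ → ℕ → ℕ) b n →
           (y^ e q^ k · (λ b n → Σ< N (λ i → F i b n))) b n ≡ Σ< N (λ i → (y^ e q^ k · F i) b n)
  y^q^-Σ e k N F b n with k ≤ᵇ n | e ≤ᵇ b
  ... | true  | true  = refl
  ... | true  | false = sym (Σ<-zero N (λ _ → refl))
  ... | false | _     = sym (Σ<-zero N (λ _ → refl))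

  y^q^-if : ∀ e k (c : Bool) (F : ℕ → ℕ → ℕ) b n →
            (y^ e q^ k · (λ b n → if c then F b n else 0)) b n ≡ (if c then (y^ e q^ k · F) b n else 0)
  y^q^-if e k c F b n with k ≤ᵇ n | e ≤ᵇ b | c
  ... | true  | true  | _     = refl
  ... | true  | false | true  = refl
  ... | true  | false | false = refl
  ... | false | _     | true  = refl
  ... | false | _     | false = refl

  y^q^-+ : ∀ e k (F F' : ℕ → ℕ → ℕ) b n →
           (y^ e q^ k · (λ b n → F b n + F' b n)) b n ≡ (y^ e q^ k · F) b n + (y^ e q^ k · F') b n
  y^q^-+ e k F F' b n with k ≤ᵇ n | e ≤ᵇ b
  ... | true  | true  = refl
  ... | true  | false = refl
  ... | false | _     = refl

  y^q^-0 : ∀ e k b n → (y^ e q^ k · (λ _ _ → 0)) b n ≡ 0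
  y^q^-0 e k b n with k ≤ᵇ n | e ≤ᵇ b
  ... | true  | true  = refl
  ... | true  | false = refl
  ... | false | _     = refl

  y^q^-over : ∀ e k F b n → n < k → (y^ e q^ k · F) b n ≡ 0
  y^q^-over e k F b n lt rewrite >⇒≤ᵇ≡false lt = refl

  y^q^-guard : ∀ e k F b n → (if k ≤ᵇ n then (y^ e q^ k · F) b n else 0) ≡ (y^ e q^ k · F) b n
  y^q^-guard e k F b n with k ≤ᵇ n
  ... | true  = refl
  ... | false = refl

  y^q^-Σ-monomials : ∀ e k N (c : ℕ → Bool) (d : ℕ → ℕ) (G : ℕ → ℕ → ℕ → ℕ) b n →
    (y^ e q^ k · (λ b n → Σ₁ N (λ p → if c p then (y^ d p q^ p · G p) b n else 0))) b n
    ≡ Σ₁ N (λ p → if c p then (y^ e + d p q^ k + p · G p) b n else 0)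
  y^q^-Σ-monomials e k N c d G b n =
    trans (y^q^-Σ e k N (λ i b n → if c (suc i) then (y^ d (suc i) q^ suc i · G (suc i)) b n else 0) b n)
          (Σ<-cong N (λ i _ → trans (y^q^-if e k (c (suc i)) (y^ d (suc i) q^ suc i · G (suc i)) b n)
                                    (cong (λ x → if c (suc i) then x else 0) (y^q^-comp e k (d (suc i)) (suc i) (G (suc i)) b n))))

module Gaps where

  open Arithmetic
  open import Data.Nat using (ℕ; suc; _+_; _∸_; _≤_; _≤ᵇ_; z≤n; s≤s)
  open import Data.Nat.Properties
  open import Data.Nat.Divisibility using (_∣_; _∣?_; divides; ∣m∣n⇒∣m+n; ∣m+n∣m⇒∣n)
  open import Data.Bool using (true; false; if_then_else_)
  open import Relation.Binary.PropositionalEquality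
  open import Relation.Nullary using (yes; no)
  open import Relation.Nullary.Decidable using (does; does-⇔)
  open import Function.Bundles using (mk⇔)

  evenness : ℕ → ℕ
  evenness p = if does (2 ∣? p) then 1 else 0

  gap : ℕ → ℕ
  gap p = if does (3 ∣? p) then 4 else 3

  nextMax : ℕ → ℕ
  nextMax p = p ∸ gap p

  nextMax≤ : ∀ p → nextMax p ≤ p
  nextMax≤ p = m∸n≤m p (gap p)

  ∣?-+-multiple : ∀ d m p → d ∣ m → does (d ∣? (m + p)) ≡ does (d ∣? p)
  ∣?-+-multiple d m p d∣m = does-⇔ (mk⇔ (λ h → ∣m+n∣m⇒∣n h d∣m) (∣m∣n⇒∣m+n d∣m)) (d ∣? (m + p)) (d ∣? p)

  gap-+3 : ∀ p → gap (3 + p) ≡ gap p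
  gap-+3 p = cong (λ c → if c then 4 else 3) (∣?-+-multiple 3 3 p (divides 1 refl))

  gap-+6 : ∀ p → gap (6 + p) ≡ gap p
  gap-+6 p = trans (gap-+3 (3 + p)) (gap-+3 p)

  evenness-+6 : ∀ p → evenness (6 + p) ≡ evenness p
  evenness-+6 p = cong (λ c → if c then 1 else 0) (∣?-+-multiple 2 6 p (divides 3 refl))

  3≤gap : ∀ p → 3 ≤ gap p
  3≤gap p with does (3 ∣? p)
  ... | true  = s≤s (s≤s (s≤s z≤n))
  ... | false = ≤-refl

  gap≤4 : ∀ p → gap p ≤ 4
  gap≤4 p with does (3 ∣? p)
  ... | true  = ≤-refl
  ... | false = s≤s (s≤s (s≤s z≤n))

  gapOK≡≤ᵇnextMax : ∀ p q → gapOK p (suc q) ≡ (suc q ≤ᵇ nextMax p)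
  gapOK≡≤ᵇnextMax p q with does (3 ∣? p)
  ... | true  = sym (≤ᵇ-∸ q 4 p)
  ... | false = sym (≤ᵇ-∸ q 3 p)

  gap-transfer : ∀ q p c c' → 3 ≤ c → c' ≤ 4 → (3 + q ≡ p → c ≡ c') → q + c ≤ p → q + c' ≤ p
  gap-transfer q p c c' 3≤c c'≤4 same-at-3 q+c≤p with 3 + q ≟ p
  ... | yes e = subst (λ z → q + z ≤ p) (same-at-3 e) q+c≤p
  ... | no ne = ≤-trans (+-monoʳ-≤ q c'≤4) (subst (_≤ p) (sym (+-suc q 3)) (≤∧≢⇒< q+3≤p (λ e → ne (trans (+-comm 3 q) e))))
    where
    q+3≤p : q + 3 ≤ p
    q+3≤p = ≤-trans (+-monoʳ-≤ q 3≤c) q+c≤p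

  -- gapOK measures the gap at the larger part p, but it can be measured at q instead: if p = q + 3 the
  -- two gaps agree (p ≡ q mod 3), and otherwise a gap of 3 or of 4 imposes the same condition.
  gap-symmetric : ∀ q p → (suc q ≤ᵇ nextMax p) ≡ (suc q + gap (suc q) ≤ᵇ p)
  gap-symmetric q p = trans (≤ᵇ-∸ q (gap p) p)
    (≤ᵇ-cong (gap-transfer (suc q) p (gap p) (gap (suc q)) (3≤gap p) (gap≤4 (suc q)) (λ e → trans (sym (cong gap e)) (gap-+3 (suc q))))
             (gap-transfer (suc q) p (gap (suc q)) (gap p) (3≤gap (suc q)) (gap≤4 p) (λ e → trans (sym (gap-+3 (suc q))) (cong gap e))))

  consecutive-parts : ∀ m p q (v : ℕ) →
    (if m ≤ᵇ p then (if suc q ≤ᵇ nextMax p then (if m ≤ᵇ suc q then v else 0) else 0) else 0)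
    ≡ (if m ≤ᵇ suc q then (if suc q + gap (suc q) ≤ᵇ p then v else 0) else 0)
  consecutive-parts m p q v =
    trans (if-if-swap (m ≤ᵇ p) (suc q ≤ᵇ nextMax p) (m ≤ᵇ suc q) v m≤p)
          (cong (λ c → if m ≤ᵇ suc q then (if c then v else 0) else 0) (gap-symmetric q p))
    where
    m≤p : (suc q ≤ᵇ nextMax p) ≡ true → (m ≤ᵇ suc q) ≡ true → (m ≤ᵇ p) ≡ true
    m≤p q<p m≤q = ≤⇒≤ᵇ≡true (≤-trans (≤ᵇ≡true⇒≤ m (suc q) m≤q) (≤-trans (≤ᵇ≡true⇒≤ (suc q) (nextMax p) q<p) (nextMax≤ p)))

module Counting where

  open Arithmetic
  open Gaps
  open import Data.Nat using (ℕ; zero; suc; _+_; _*_; _∸_; _≤_; _<_; _⊓_; _≤ᵇ_)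
  open import Data.Nat.Properties
  open import Data.Bool using (true; false; _∧_; if_then_else_)
  open import Data.Bool.Properties using (if-eta)
  open import Relation.Binary.PropositionalEquality

  -- count m u a b n is the number of λ ∈ 𝒮 with all parts in [m, u], ♯ λ = a, ♯₀₂ λ = b and |λ| = n:
  -- removing the largest part p leaves a partition with parts at most nextMax p.
  count : ℕ → ℕ → ℕ → ℕ → ℕ → ℕ
  count m u zero    zero    zero    = 1
  count m u zero    zero    (suc n) = 0
  count m u zero    (suc b) n       = 0
  count m u (suc a) b n = Σ₁ u (λ p → if m ≤ᵇ p then (y^ evenness p q^ p · count m (nextMax p) a) b n else 0)

  count-no-parts : ∀ m u m' u' b n → count m u 0 b n ≡ count m' u' 0 b n
  count-no-parts m u m' u' zero    zero    = refl
  count-no-parts m u m' u' zero    (suc n) = refl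
  count-no-parts m u m' u' (suc b) n       = refl

  count-no-parts-suc : ∀ m u b n → count m u 0 b (suc n) ≡ 0
  count-no-parts-suc m u zero    n = refl
  count-no-parts-suc m u (suc b) n = refl

  count-by-smallest : ∀ a m u b n →
    count m u (suc a) b n ≡ Σ₁ u (λ p → if m ≤ᵇ p then (y^ evenness p q^ p · count (p + gap p) u a) b n else 0)
  count-by-smallest zero m u b n =
    Σ<-cong u (λ i _ → cong (λ x → if m ≤ᵇ suc i then x else 0)
      (y^q^-cong (evenness (suc i)) (suc i) (count m (nextMax (suc i)) 0) (count (suc i + gap (suc i)) u 0) b n
        (λ b' → count-no-parts m (nextMax (suc i)) (suc i + gap (suc i)) u b' (n ∸ suc i))))
  count-by-smallest (suc a) m u b n = begin
      Σ₁ u (λ p → if m ≤ᵇ p then (y^ evenness p q^ p · count m (nextMax p) (suc a)) b n else 0)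
    ≡⟨ Σ<-cong u (λ i i<u → largest-first (suc i) i<u) ⟩
      Σ₁ u (λ p → Σ₁ u (λ q → if m ≤ᵇ p then (if q ≤ᵇ nextMax p then (if m ≤ᵇ q then term p q else 0) else 0) else 0))
    ≡⟨ Σ<-swap u u _ ⟩
      Σ₁ u (λ q → Σ₁ u (λ p → if m ≤ᵇ p then (if q ≤ᵇ nextMax p then (if m ≤ᵇ q then term p q else 0) else 0) else 0))
    ≡⟨ Σ<-cong u (λ j _ → Σ<-cong u (λ i _ → consecutive-parts m (suc i) j (term (suc i) (suc j)))) ⟩
      Σ₁ u (λ q → Σ₁ u (λ p → if m ≤ᵇ q then (if q + gap q ≤ᵇ p then term p q else 0) else 0))
    ≡⟨ Σ<-cong u (λ j _ → sym (smallest-first (suc j))) ⟩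
      Σ₁ u (λ q → if m ≤ᵇ q then (y^ evenness q q^ q · count (q + gap q) u (suc a)) b n else 0)
    ∎
    where
    open ≡-Reasoning
    H : ℕ → ℕ → ℕ → ℕ → ℕ
    H p q = count (q + gap q) (nextMax p) a
    term : ℕ → ℕ → ℕ
    term p q = (y^ evenness p + evenness q q^ p + q · H p q) b n

    largest-first : ∀ p → p ≤ u → (if m ≤ᵇ p then (y^ evenness p q^ p · count m (nextMax p) (suc a)) b n else 0)
                                ≡ Σ₁ u (λ q → if m ≤ᵇ p then (if q ≤ᵇ nextMax p then (if m ≤ᵇ q then term p q else 0) else 0) else 0)
    largest-first p p≤u = trans (cong (λ x → if m ≤ᵇ p then x else 0) (begin
        (y^ evenness p q^ p · count m (nextMax p) (suc a)) b n
      ≡⟨ y^q^-cong (evenness p) p (count m (nextMax p) (suc a))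
                   (λ b n → Σ₁ (nextMax p) (λ q → if m ≤ᵇ q then (y^ evenness q q^ q · H p q) b n else 0)) b n
                   (λ b' → count-by-smallest a m (nextMax p) b' (n ∸ p)) ⟩
        (y^ evenness p q^ p · (λ b n → Σ₁ (nextMax p) (λ q → if m ≤ᵇ q then (y^ evenness q q^ q · H p q) b n else 0))) b n
      ≡⟨ y^q^-Σ-monomials (evenness p) p (nextMax p) (m ≤ᵇ_) evenness (H p) b n ⟩
        Σ₁ (nextMax p) (λ q → if m ≤ᵇ q then term p q else 0)
      ≡⟨ Σ₁-extend (nextMax p) u (λ q → if m ≤ᵇ q then term p q else 0) (≤-trans (nextMax≤ p) p≤u) ⟩
        Σ₁ u (λ q → if q ≤ᵇ nextMax p then (if m ≤ᵇ q then term p q else 0) else 0)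
      ∎)) (Σ<-if (m ≤ᵇ p) u _)

    smallest-first : ∀ q → (if m ≤ᵇ q then (y^ evenness q q^ q · count (q + gap q) u (suc a)) b n else 0)
                         ≡ Σ₁ u (λ p → if m ≤ᵇ q then (if q + gap q ≤ᵇ p then term p q else 0) else 0)
    smallest-first q =
      trans (cong (λ x → if m ≤ᵇ q then x else 0)
                  (trans (y^q^-Σ-monomials (evenness q) q u (q + gap q ≤ᵇ_) evenness (λ p → H p q) b n)
                         (Σ<-cong u (λ i _ → cong (λ x → if q + gap q ≤ᵇ suc i then x else 0) (swap-pq (suc i))))))
            (Σ<-if (m ≤ᵇ q) u _)
      where
      swap-pq : ∀ p → (y^ evenness q + evenness p q^ q + p · H p q) b n ≡ term p q
      swap-pq p = cong₂ (λ e k → (y^ e q^ k · H p q) b n) (+-comm (evenness q) (evenness p)) (+-comm q p)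

  count-bound : ∀ a m u b n → n ≤ u → count m u a b n ≡ count m n a b n
  count-bound zero    m u b n _   = count-no-parts m u m n b n
  count-bound (suc a) m u b n n≤u = Σ₁-truncate n u _ n≤u vanish
    where
    vanish : ∀ p → n < p → (if m ≤ᵇ p then (y^ evenness p q^ p · count m (nextMax p) a) b n else 0) ≡ 0
    vanish p n<p with m ≤ᵇ p
    ... | true  = y^q^-over (evenness p) p (count m (nextMax p) a) b n n<p
    ... | false = refl

  -- partitions of n + 1 in 𝒮 with a parts, b even parts and largest part i + 1
  largestPart : ℕ → ℕ → ℕ → ℕ → ℕ
  largestPart a b n i =
    if (1 ≤ᵇ a) ∧ (evenness (suc i) ≤ᵇ b) then count 1 (nextMax (suc i)) (a ∸ 1) (b ∸ evenness (suc i)) (n ∸ i) else 0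

  count-by-largest : ∀ a b n → Σ< (suc n) (λ i → if suc i ≤ᵇ suc n then largestPart a b n i else 0) ≡ count 1 (suc n) a b (suc n)
  count-by-largest zero    b n = trans (Σ<-zero (suc n) (λ i → if-eta (suc i ≤ᵇ suc n))) (sym (count-no-parts-suc 1 (suc n) b n))
  count-by-largest (suc a) b n = refl

  count-below-by-largest : ∀ p a b n →
    Σ< (suc n) (λ i → if suc i ≤ᵇ p then (if gapOK p (suc i) then largestPart a b n i else 0) else 0) ≡ count 1 (nextMax p) a b (suc n)
  count-below-by-largest p zero b n =
    trans (Σ<-zero (suc n) (λ i → trans (cong (λ x → if suc i ≤ᵇ p then x else 0) (if-eta (gapOK p (suc i)))) (if-eta (suc i ≤ᵇ p))))
          (sym (count-no-parts-suc 1 (nextMax p) b n))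
  count-below-by-largest p (suc a) b n = begin
      Σ< (suc n) (λ i → if suc i ≤ᵇ p then (if gapOK p (suc i) then W i else 0) else 0)
    ≡⟨ Σ<-cong (suc n) (λ i _ → trans (cong (λ c → if suc i ≤ᵇ p then (if c then W i else 0) else 0) (gapOK≡≤ᵇnextMax p i))
                                      (if-absorb (suc i ≤ᵇ p) (suc i ≤ᵇ nextMax p) (W i) (below-p i))) ⟩
      Σ< (suc n) (λ i → if suc i ≤ᵇ nextMax p then W i else 0)
    ≡⟨ Σ<-⊓ (suc n) (nextMax p) W ⟩
      Σ< (suc n ⊓ nextMax p) W
    ≡⟨ cong (λ z → Σ< z W) (⊓-comm (suc n) (nextMax p)) ⟩
      Σ< (nextMax p ⊓ suc n) W
    ≡⟨ sym (Σ<-⊓ (nextMax p) (suc n) W) ⟩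
      count 1 (nextMax p) (suc a) b (suc n)
    ∎
    where
    open ≡-Reasoning
    W : ℕ → ℕ
    W = largestPart (suc a) b n
    below-p : ∀ i → (suc i ≤ᵇ nextMax p) ≡ true → (suc i ≤ᵇ p) ≡ true
    below-p i e = ≤⇒≤ᵇ≡true (≤-trans (≤ᵇ≡true⇒≤ (suc i) (nextMax p) e) (nextMax≤ p))

  -- countFrom m a b n is the coefficient of x^a y^b q^n in B_m
  countFrom : ℕ → ℕ → ℕ → ℕ → ℕ
  countFrom m a b n = count m n a b n

  smallestPart : ℕ → ℕ → ℕ → ℕ → ℕ
  smallestPart m zero    b n = 0
  smallestPart m (suc a) b n = (y^ evenness m q^ m · countFrom (m + gap m) a) b n

  countFrom-suc : ∀ m a b n → countFrom (suc m) a b n ≡ countFrom (suc (suc m)) a b n + smallestPart (suc m) a b n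
  countFrom-suc m zero    b n = sym (trans (+-identityʳ _) (count-no-parts (suc (suc m)) n (suc m) n b n))
  countFrom-suc m (suc a) b n = begin
      count (suc m) n (suc a) b n
    ≡⟨ count-by-smallest a (suc m) n b n ⟩
      Σ₁ n (λ p → if suc m ≤ᵇ p then F p else 0)
    ≡⟨ Σ₁-peel n m F ⟩
      Σ₁ n (λ p → if suc (suc m) ≤ᵇ p then F p else 0) + (if suc m ≤ᵇ n then F (suc m) else 0)
    ≡⟨ cong₂ _+_ (sym (count-by-smallest a (suc (suc m)) n b n))
                 (trans (y^q^-guard (evenness (suc m)) (suc m) (count (suc m + gap (suc m)) n a) b n)
                        (y^q^-cong (evenness (suc m)) (suc m) (count (suc m + gap (suc m)) n a) (countFrom (suc m + gap (suc m)) a) b n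
                                   (λ b' → count-bound a (suc m + gap (suc m)) n b' (n ∸ suc m) (m∸n≤m n (suc m))))) ⟩
      count (suc (suc m)) n (suc a) b n + smallestPart (suc m) (suc a) b n
    ∎
    where
    open ≡-Reasoning
    F : ℕ → ℕ
    F p = (y^ evenness p q^ p · count (p + gap p) n a) b n

  -- Adding 6 to every part preserves parity and residue mod 3, hence membership in 𝒮.
  count-+6 : ∀ a m u b n → count (6 + suc m) (6 + u) a b n ≡ (y^ 0 q^ (a * 6) · count (suc m) u a) b n
  count-+6 zero    m u b n = count-no-parts _ _ _ _ b n
  count-+6 (suc a) m u b n = begin
      count (6 + suc m) (6 + u) (suc a) b n
    ≡⟨ count-by-smallest a (6 + suc m) (6 + u) b n ⟩
      Σ₁ (6 + u) (λ p → if 6 + suc m ≤ᵇ p then (y^ evenness p q^ p · count (p + gap p) (6 + u) a) b n else 0)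
    ≡⟨ Σ<-split 6 u (λ i → if 6 + suc m ≤ᵇ suc i then (y^ evenness (suc i) q^ suc i · count (suc i + gap (suc i)) (6 + u) a) b n else 0) ⟩
      Σ₁ u (λ p → if suc m ≤ᵇ p then (y^ evenness (6 + p) q^ 6 + p · count (6 + p + gap (6 + p)) (6 + u) a) b n else 0)
    ≡⟨ Σ<-cong u (λ i _ → cong (λ x → if suc m ≤ᵇ suc i then x else 0) (shifted i)) ⟩
      Σ₁ u (λ p → if suc m ≤ᵇ p then (y^ evenness p q^ 6 + a * 6 + p · count (p + gap p) u a) b n else 0)
    ≡⟨ sym (y^q^-Σ-monomials 0 (6 + a * 6) u (suc m ≤ᵇ_) evenness (λ p → count (p + gap p) u a) b n) ⟩
      (y^ 0 q^ 6 + a * 6 · (λ b n → Σ₁ u (λ p → if suc m ≤ᵇ p then (y^ evenness p q^ p · count (p + gap p) u a) b n else 0))) b n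
    ≡⟨ y^q^-cong 0 (6 + a * 6) (λ b n → Σ₁ u (λ p → if suc m ≤ᵇ p then (y^ evenness p q^ p · count (p + gap p) u a) b n else 0))
                 (count (suc m) u (suc a)) b n (λ b' → sym (count-by-smallest a (suc m) u b' (n ∸ (6 + a * 6)))) ⟩
      (y^ 0 q^ suc a * 6 · count (suc m) u (suc a)) b n
    ∎
    where
    open ≡-Reasoning
    shifted : ∀ i → let p = suc i in
              (y^ evenness (6 + p) q^ 6 + p · count (6 + p + gap (6 + p)) (6 + u) a) b n
              ≡ (y^ evenness p q^ 6 + a * 6 + p · count (p + gap p) u a) b n
    shifted i rewrite evenness-+6 (suc i) | gap-+6 (suc i) = begin
        (y^ evenness p q^ 6 + p · count (6 + (p + gap p)) (6 + u) a) b n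
      ≡⟨ y^q^-cong (evenness p) (6 + p) (count (6 + (p + gap p)) (6 + u) a) (y^ 0 q^ a * 6 · count (p + gap p) u a) b n
                   (λ b' → count-+6 a (i + gap p) u b' (n ∸ (6 + p))) ⟩
        (y^ evenness p q^ 6 + p · y^ 0 q^ a * 6 · count (p + gap p) u a) b n
      ≡⟨ y^q^-comp (evenness p) (6 + p) 0 (a * 6) (count (p + gap p) u a) b n ⟩
        (y^ evenness p + 0 q^ 6 + p + a * 6 · count (p + gap p) u a) b n
      ≡⟨ cong₂ (λ e k → (y^ e q^ k · count (p + gap p) u a) b n) (+-identityʳ (evenness p)) (cong (6 +_) (+-comm p (a * 6))) ⟩
        (y^ evenness p q^ 6 + a * 6 + p · count (p + gap p) u a) b n
      ∎
      where p = suc i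

  countFrom-+6 : ∀ m a b n → countFrom (6 + suc m) a b n ≡ (y^ 0 q^ (a * 6) · countFrom (suc m) a) b n
  countFrom-+6 m a b n = begin
      count (6 + suc m) n a b n
    ≡⟨ sym (count-bound a (6 + suc m) (6 + n) b n (m≤n+m n 6)) ⟩
      count (6 + suc m) (6 + n) a b n
    ≡⟨ count-+6 a m n b n ⟩
      (y^ 0 q^ (a * 6) · count (suc m) n a) b n
    ≡⟨ y^q^-cong 0 (a * 6) (count (suc m) n a) (countFrom (suc m) a) b n
                 (λ b' → count-bound a (suc m) n b' (n ∸ a * 6) (m∸n≤m n (a * 6))) ⟩
      (y^ 0 q^ (a * 6) · countFrom (suc m) a) b n
    ∎
    where open ≡-Reasoning

  countFrom-shift : ∀ t a b n → countFrom (suc (t * 6)) a b n ≡ (y^ 0 q^ (t * 6 * a) · countFrom 1 a) b n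
  countFrom-shift zero    a b n = refl
  countFrom-shift (suc t) a b n = begin
      countFrom (6 + suc (t * 6)) a b n
    ≡⟨ countFrom-+6 (t * 6) a b n ⟩
      (y^ 0 q^ (a * 6) · countFrom (suc (t * 6)) a) b n
    ≡⟨ y^q^-cong 0 (a * 6) (countFrom (suc (t * 6)) a) (y^ 0 q^ (t * 6 * a) · countFrom 1 a) b n
                 (λ b' → countFrom-shift t a b' (n ∸ a * 6)) ⟩
      (y^ 0 q^ (a * 6) · y^ 0 q^ (t * 6 * a) · countFrom 1 a) b n
    ≡⟨ y^q^-comp 0 (a * 6) 0 (t * 6 * a) (countFrom 1 a) b n ⟩
      (y^ 0 q^ (a * 6 + t * 6 * a) · countFrom 1 a) b n
    ≡⟨ cong (λ k → (y^ 0 q^ k · countFrom 1 a) b n) (trans (cong (_+ t * 6 * a) (*-comm a 6)) (sym (*-distribʳ-+ a 6 (t * 6)))) ⟩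
      (y^ 0 q^ (suc t * 6 * a) · countFrom 1 a) b n
    ∎
    where open ≡-Reasoning

module Enumeration where

  open Arithmetic
  open Gaps
  open Counting
  open import Data.Nat using (ℕ; zero; suc; _+_; _∸_; _≤_; _≤ᵇ_; _≡ᵇ_; _≤?_; s≤s)
  open import Data.Nat.Properties using (≤-trans; m∸n≤m; +-assoc)
  open import Data.Nat.ListAction using (sum)
  open import Data.Nat.Divisibility using (_∣?_)
  open import Data.Bool using (Bool; true; false; _∧_; if_then_else_; T?)
  open import Data.Bool.Properties using (∧-assoc; ∧-zeroʳ)
  open import Data.List using (List; []; _∷_; map; concatMap; filter; applyUpTo; length; _++_)
  open import Relation.Binary.PropositionalEquality
  open import Relation.Nullary using (Dec)
  open import Relation.Nullary.Decidable using (does)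

  countTrue : {A : Set} → (A → Bool) → List A → ℕ
  countTrue h []       = 0
  countTrue h (x ∷ xs) = (if h x then 1 else 0) + countTrue h xs

  length-filter≡countTrue : {A : Set} (h : A → Bool) (xs : List A) → length (filter (λ x → T? (h x)) xs) ≡ countTrue h xs
  length-filter≡countTrue h []       = refl
  length-filter≡countTrue h (x ∷ xs) with h x
  ... | true  = cong suc (length-filter≡countTrue h xs)
  ... | false = length-filter≡countTrue h xs

  countTrue-++ : {A : Set} (h : A → Bool) (xs ys : List A) → countTrue h (xs ++ ys) ≡ countTrue h xs + countTrue h ys
  countTrue-++ h []       ys = refl
  countTrue-++ h (x ∷ xs) ys rewrite countTrue-++ h xs ys = sym (+-assoc (if h x then 1 else 0) _ _)

  countTrue-concatMap : {A B : Set} (h : A → Bool) (g : B → List A) (xs : List B) →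
                        countTrue h (concatMap g xs) ≡ sum (map (λ x → countTrue h (g x)) xs)
  countTrue-concatMap h g []       = refl
  countTrue-concatMap h g (x ∷ xs) = trans (countTrue-++ h (g x) (concatMap g xs)) (cong (countTrue h (g x) +_) (countTrue-concatMap h g xs))

  countTrue-map : {A B : Set} (h : A → Bool) (g : B → A) (xs : List B) → countTrue h (map g xs) ≡ countTrue (λ x → h (g x)) xs
  countTrue-map h g []       = refl
  countTrue-map h g (x ∷ xs) = cong ((if h (g x) then 1 else 0) +_) (countTrue-map h g xs)

  countTrue-cong : {A : Set} {h h' : A → Bool} (xs : List A) → (∀ x → h x ≡ h' x) → countTrue h xs ≡ countTrue h' xs
  countTrue-cong          []       e = refl
  countTrue-cong {h' = h'} (x ∷ xs) e rewrite e x = cong ((if h' x then 1 else 0) +_) (countTrue-cong xs e)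

  countTrue-∧ : {A : Set} (c : Bool) (h : A → Bool) (xs : List A) → countTrue (λ x → c ∧ h x) xs ≡ (if c then countTrue h xs else 0)
  countTrue-∧ true  h xs       = refl
  countTrue-∧ false h []       = refl
  countTrue-∧ false h (x ∷ xs) = countTrue-∧ false h xs

  sum-map-filter : ∀ {P : ℕ → Set} (P? : (x : ℕ) → Dec (P x)) (F : ℕ → ℕ) xs →
                   sum (map F (filter P? xs)) ≡ sum (map (λ x → if does (P? x) then F x else 0) xs)
  sum-map-filter P? F []       = refl
  sum-map-filter P? F (x ∷ xs) with does (P? x)
  ... | true  = cong (F x +_) (sum-map-filter P? F xs)
  ... | false = sum-map-filter P? F xs

  sum-map-applyUpTo : ∀ (F : ℕ → ℕ) g k → sum (map F (applyUpTo g k)) ≡ Σ< k (λ i → F (g i))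
  sum-map-applyUpTo F g zero    = refl
  sum-map-applyUpTo F g (suc k) = cong (F (g 0) +_) (sum-map-applyUpTo F (λ i → g (suc i)) k)

  countTrue-partitionsBounded : ∀ (h : List ℕ → Bool) f w n →
    countTrue h (partitionsBounded (suc f) w (suc n))
    ≡ Σ< (suc n) (λ i → if suc i ≤ᵇ w then countTrue (λ l → h (suc i ∷ l)) (partitionsBounded f (suc i) (n ∸ i)) else 0)
  countTrue-partitionsBounded h f w n = begin
      countTrue h (concatMap g (filter (_≤? w) (applyUpTo suc (suc n))))
    ≡⟨ countTrue-concatMap h g (filter (_≤? w) (applyUpTo suc (suc n))) ⟩
      sum (map (λ p → countTrue h (g p)) (filter (_≤? w) (applyUpTo suc (suc n))))
    ≡⟨ sum-map-filter (_≤? w) (λ p → countTrue h (g p)) (applyUpTo suc (suc n)) ⟩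
      sum (map (λ p → if p ≤ᵇ w then countTrue h (g p) else 0) (applyUpTo suc (suc n)))
    ≡⟨ sum-map-applyUpTo (λ p → if p ≤ᵇ w then countTrue h (g p) else 0) suc (suc n) ⟩
      Σ< (suc n) (λ i → if suc i ≤ᵇ w then countTrue h (g (suc i)) else 0)
    ≡⟨ Σ<-cong (suc n) (λ i _ → cong (λ x → if suc i ≤ᵇ w then x else 0) (countTrue-map h (suc i ∷_) (partitionsBounded f (suc i) (n ∸ i)))) ⟩
      Σ< (suc n) (λ i → if suc i ≤ᵇ w then countTrue (λ l → h (suc i ∷ l)) (partitionsBounded f (suc i) (n ∸ i)) else 0)
    ∎
    where
    open ≡-Reasoning
    g : ℕ → List (List ℕ)
    g p = map (p ∷_) (partitionsBounded f p (suc n ∸ p))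

  fits : ℕ → ℕ → List ℕ → Bool
  fits a b l = inS l ∧ (♯ l ≡ᵇ a) ∧ (♯₀₂ l ≡ᵇ b)

  fitsBelow : ℕ → ℕ → ℕ → List ℕ → Bool
  fitsBelow p a b l = inS (p ∷ l) ∧ (♯ l ≡ᵇ a) ∧ (♯₀₂ l ≡ᵇ b)

  ≡ᵇ-suc : ∀ x a → (suc x ≡ᵇ a) ≡ ((1 ≤ᵇ a) ∧ (x ≡ᵇ a ∸ 1))
  ≡ᵇ-suc x zero    = refl
  ≡ᵇ-suc x (suc a) = refl

  ♯₀₂-∷ : ∀ q l b → (♯₀₂ (q ∷ l) ≡ᵇ b) ≡ ((evenness q ≤ᵇ b) ∧ (♯₀₂ l ≡ᵇ b ∸ evenness q))
  ♯₀₂-∷ q l b with does (2 ∣? q)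
  ... | true  = ≡ᵇ-suc (♯₀₂ l) b
  ... | false = refl

  ∧-shuffle : ∀ s a₁ a₂ b₁ b₂ → (s ∧ (a₁ ∧ a₂) ∧ (b₁ ∧ b₂)) ≡ ((a₁ ∧ b₁) ∧ (s ∧ a₂ ∧ b₂))
  ∧-shuffle false a₁    a₂ b₁    b₂ = sym (∧-zeroʳ (a₁ ∧ b₁))
  ∧-shuffle true  false a₂ b₁    b₂ = refl
  ∧-shuffle true  true  a₂ false b₂ = ∧-zeroʳ a₂
  ∧-shuffle true  true  a₂ true  b₂ = refl

  fits-∷ : ∀ q l a b → fits a b (q ∷ l) ≡ ((1 ≤ᵇ a) ∧ (evenness q ≤ᵇ b)) ∧ fitsBelow q (a ∸ 1) (b ∸ evenness q) l
  fits-∷ q l a b rewrite ≡ᵇ-suc (♯ l) a | ♯₀₂-∷ q l b =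
    ∧-shuffle (inS (q ∷ l)) (1 ≤ᵇ a) (♯ l ≡ᵇ a ∸ 1) (evenness q ≤ᵇ b) (♯₀₂ l ≡ᵇ b ∸ evenness q)

  fitsBelow-∷ : ∀ p q l a b → fitsBelow p a b (q ∷ l) ≡ gapOK p q ∧ fits a b (q ∷ l)
  fitsBelow-∷ p q l a b = ∧-assoc (gapOK p q) (inS (q ∷ l)) _

  countTrue-fits-∷ : ∀ f n q a b → n ≤ f →
    countTrue (λ l → fits a b (q ∷ l)) (partitionsBounded f q n)
    ≡ (if (1 ≤ᵇ a) ∧ (evenness q ≤ᵇ b) then count 1 (nextMax q) (a ∸ 1) (b ∸ evenness q) n else 0)

  countTrue-fitsBelow : ∀ f n p a b → n ≤ f → countTrue (fitsBelow p a b) (partitionsBounded f p n) ≡ count 1 (nextMax p) a b n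

  countTrue-fits-∷ f n q a b n≤f = begin
      countTrue (λ l → fits a b (q ∷ l)) (partitionsBounded f q n)
    ≡⟨ countTrue-cong (partitionsBounded f q n) (λ l → fits-∷ q l a b) ⟩
      countTrue (λ l → c ∧ fitsBelow q (a ∸ 1) (b ∸ evenness q) l) (partitionsBounded f q n)
    ≡⟨ countTrue-∧ c (fitsBelow q (a ∸ 1) (b ∸ evenness q)) (partitionsBounded f q n) ⟩
      (if c then countTrue (fitsBelow q (a ∸ 1) (b ∸ evenness q)) (partitionsBounded f q n) else 0)
    ≡⟨ cong (λ x → if c then x else 0) (countTrue-fitsBelow f n q (a ∸ 1) (b ∸ evenness q) n≤f) ⟩
      (if c then count 1 (nextMax q) (a ∸ 1) (b ∸ evenness q) n else 0)
    ∎
    where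
    open ≡-Reasoning
    c = (1 ≤ᵇ a) ∧ (evenness q ≤ᵇ b)

  countTrue-fitsBelow f       zero    p zero    zero    _ = refl
  countTrue-fitsBelow f       zero    p zero    (suc b) _ = refl
  countTrue-fitsBelow f       zero    p (suc a) b       _ = sym (Σ<-zero (nextMax p) (λ _ → refl))
  countTrue-fitsBelow (suc f) (suc n) p a b (s≤s n≤f) = begin
      countTrue (fitsBelow p a b) (partitionsBounded (suc f) p (suc n))
    ≡⟨ countTrue-partitionsBounded (fitsBelow p a b) f p n ⟩
      Σ< (suc n) (λ i → if suc i ≤ᵇ p then countTrue (λ l → fitsBelow p a b (suc i ∷ l)) (partitionsBounded f (suc i) (n ∸ i)) else 0)
    ≡⟨ Σ<-cong (suc n) (λ i _ → cong (λ x → if suc i ≤ᵇ p then x else 0) (branch i)) ⟩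
      Σ< (suc n) (λ i → if suc i ≤ᵇ p then (if gapOK p (suc i) then largestPart a b n i else 0) else 0)
    ≡⟨ count-below-by-largest p a b n ⟩
      count 1 (nextMax p) a b (suc n)
    ∎
    where
    open ≡-Reasoning
    branch : ∀ i → countTrue (λ l → fitsBelow p a b (suc i ∷ l)) (partitionsBounded f (suc i) (n ∸ i))
                 ≡ (if gapOK p (suc i) then largestPart a b n i else 0)
    branch i = trans (countTrue-cong (partitionsBounded f (suc i) (n ∸ i)) (λ l → fitsBelow-∷ p (suc i) l a b))
                 (trans (countTrue-∧ (gapOK p (suc i)) (λ l → fits a b (suc i ∷ l)) (partitionsBounded f (suc i) (n ∸ i)))
                        (cong (λ x → if gapOK p (suc i) then x else 0) (countTrue-fits-∷ f (n ∸ i) (suc i) a b (≤-trans (m∸n≤m n i) n≤f))))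

  countS≡countFrom1 : ∀ a b n → countS a b n ≡ countFrom 1 a b n
  countS≡countFrom1 a b n = trans (length-filter≡countTrue (fits a b) (partitions n)) (enumerate a b n)
    where
    enumerate : ∀ a b n → countTrue (fits a b) (partitions n) ≡ countFrom 1 a b n
    enumerate zero    zero    zero    = refl
    enumerate zero    (suc b) zero    = refl
    enumerate (suc a) b       zero    = refl
    enumerate a       b       (suc n) = begin
        countTrue (fits a b) (partitionsBounded (suc n) (suc n) (suc n))
      ≡⟨ countTrue-partitionsBounded (fits a b) n (suc n) n ⟩
        Σ< (suc n) (λ i → if suc i ≤ᵇ suc n then countTrue (λ l → fits a b (suc i ∷ l)) (partitionsBounded n (suc i) (n ∸ i)) else 0)
      ≡⟨ Σ<-cong (suc n) (λ i _ → cong (λ x → if suc i ≤ᵇ suc n then x else 0) (countTrue-fits-∷ n (n ∸ i) (suc i) a b (m∸n≤m n i))) ⟩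
        Σ< (suc n) (λ i → if suc i ≤ᵇ suc n then largestPart a b n i else 0)
      ≡⟨ count-by-largest a b n ⟩
        count 1 (suc n) a b (suc n)
      ∎
      where open ≡-Reasoning

module Convolution where

  open Arithmetic using (≤⇒≤ᵇ≡true; >⇒≤ᵇ≡false)
  open import Data.Nat using (ℕ; zero; suc; _∸_; _≤ᵇ_; _≡ᵇ_; _≟_; s≤s)
  open import Data.Nat.Properties using (<-cmp; ≤-refl; ≤-trans; n≤1+n; n<1+n; <-trans)
  open import Data.Integer using (ℤ; 0ℤ; -_; _+_; _*_; _-_)
  import Data.Integer.Properties as ℤP
  open import Algebra.Properties.CommutativeSemigroup ℤP.+-commutativeSemigroup using (interchange)
  open import Data.Bool using (Bool; true; false; if_then_else_)
  open import Relation.Binary.PropositionalEquality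
  open import Relation.Binary.Definitions using (tri<; tri≈; tri>)
  open import Relation.Nullary.Decidable using (dec-true; dec-false)
  open import Data.Integer.Tactic.RingSolver using (solve-∀)

  Σ≤-cong : ∀ N {f g : ℕ → ℤ} → (∀ i → f i ≡ g i) → Σ≤ N f ≡ Σ≤ N g
  Σ≤-cong zero    h = h 0
  Σ≤-cong (suc N) h = cong₂ _+_ (Σ≤-cong N h) (h (suc N))

  Σ≤-zero : ∀ N → Σ≤ N (λ _ → 0ℤ) ≡ 0ℤ
  Σ≤-zero zero                     = refl
  Σ≤-zero (suc N) rewrite Σ≤-zero N = refl

  Σ≤-if : ∀ (c : Bool) N (f : ℕ → ℤ) → Σ≤ N (λ x → if c then f x else 0ℤ) ≡ (if c then Σ≤ N f else 0ℤ)
  Σ≤-if true  N f = refl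
  Σ≤-if false N f = Σ≤-zero N

  Σ≤-+ : ∀ N (f g : ℕ → ℤ) → Σ≤ N (λ x → f x + g x) ≡ Σ≤ N f + Σ≤ N g
  Σ≤-+ zero    f g = refl
  Σ≤-+ (suc N) f g rewrite Σ≤-+ N f g = interchange (Σ≤ N f) (Σ≤ N g) (f (suc N)) (g (suc N))

  Σ≤-neg : ∀ N (f : ℕ → ℤ) → Σ≤ N (λ x → - f x) ≡ - Σ≤ N f
  Σ≤-neg zero    f = refl
  Σ≤-neg (suc N) f rewrite Σ≤-neg N f = sym (ℤP.neg-distrib-+ (Σ≤ N f) (f (suc N)))

  Σ≤-δ : ∀ N i (f : ℕ → ℤ) → Σ≤ N (λ x → if i ≡ᵇ x then f x else 0ℤ) ≡ (if i ≤ᵇ N then f i else 0ℤ)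
  Σ≤-δ zero    zero    f = refl
  Σ≤-δ zero    (suc i) f = refl
  Σ≤-δ (suc N) i       f rewrite Σ≤-δ N i f with <-cmp i (suc N)
  ... | tri< (s≤s i≤N) i≢ _
    rewrite ≤⇒≤ᵇ≡true i≤N | dec-false (i ≟ suc N) i≢ | ≤⇒≤ᵇ≡true (≤-trans i≤N (n≤1+n N)) = ℤP.+-identityʳ (f i)
  ... | tri≈ _ refl _
    rewrite >⇒≤ᵇ≡false (n<1+n N) | dec-true (N ≟ N) refl | ≤⇒≤ᵇ≡true (≤-refl {suc N}) = ℤP.+-identityˡ (f (suc N))
  ... | tri> _ i≢ N<i
    rewrite >⇒≤ᵇ≡false (<-trans (n<1+n N) N<i) | dec-false (i ≟ suc N) i≢ | >⇒≤ᵇ≡false N<i = refl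

  Σ³ : ℕ → ℕ → ℕ → (ℕ → ℕ → ℕ → ℤ) → ℤ
  Σ³ a b n f = Σ≤ a (λ x → Σ≤ b (λ y → Σ≤ n (f x y)))

  Σ³-cong : ∀ a b n {f g : ℕ → ℕ → ℕ → ℤ} → (∀ x y z → f x y z ≡ g x y z) → Σ³ a b n f ≡ Σ³ a b n g
  Σ³-cong a b n h = Σ≤-cong a (λ x → Σ≤-cong b (λ y → Σ≤-cong n (h x y)))

  Σ³-+ : ∀ a b n (f g : ℕ → ℕ → ℕ → ℤ) → Σ³ a b n (λ x y z → f x y z + g x y z) ≡ Σ³ a b n f + Σ³ a b n g
  Σ³-+ a b n f g =
    trans (Σ≤-cong a (λ x → trans (Σ≤-cong b (λ y → Σ≤-+ n (f x y) (g x y))) (Σ≤-+ b (λ y → Σ≤ n (f x y)) (λ y → Σ≤ n (g x y)))))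
          (Σ≤-+ a (λ x → Σ≤ b (λ y → Σ≤ n (f x y))) (λ x → Σ≤ b (λ y → Σ≤ n (g x y))))

  Σ³-neg : ∀ a b n (f : ℕ → ℕ → ℕ → ℤ) → Σ³ a b n (λ x y z → - f x y z) ≡ - Σ³ a b n f
  Σ³-neg a b n f =
    trans (Σ≤-cong a (λ x → trans (Σ≤-cong b (λ y → Σ≤-neg n (f x y))) (Σ≤-neg b (λ y → Σ≤ n (f x y)))))
          (Σ≤-neg a (λ x → Σ≤ b (λ y → Σ≤ n (f x y))))

  Σ³-zero : ∀ a b n → Σ³ a b n (λ _ _ _ → 0ℤ) ≡ 0ℤ
  Σ³-zero a b n = trans (Σ≤-cong a (λ x → trans (Σ≤-cong b (λ y → Σ≤-zero n)) (Σ≤-zero b))) (Σ≤-zero a)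

  ⊛-distribʳ-⊕ : ∀ F G H a b n → ((F ⊕ G) ⊛ H) a b n ≡ (F ⊛ H) a b n + (G ⊛ H) a b n
  ⊛-distribʳ-⊕ F G H a b n =
    trans (Σ³-cong a b n (λ x y z → ℤP.*-distribʳ-+ (H (a ∸ x) (b ∸ y) (n ∸ z)) (F x y z) (G x y z))) (Σ³-+ a b n _ _)

  ⊛-distribʳ-⊖ : ∀ F G H a b n → ((F ⊖ G) ⊛ H) a b n ≡ (F ⊛ H) a b n - (G ⊛ H) a b n
  ⊛-distribʳ-⊖ F G H a b n =
    trans (Σ³-cong a b n (λ x y z → distrib (F x y z) (G x y z) (H (a ∸ x) (b ∸ y) (n ∸ z))))
          (trans (Σ³-+ a b n _ _) (cong ((F ⊛ H) a b n +_) (Σ³-neg a b n _)))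
    where
    distrib : ∀ f g h → (f - g) * h ≡ f * h + - (g * h)
    distrib = solve-∀

  𝟘-⊛ : ∀ H a b n → (𝟘 ⊛ H) a b n ≡ 0ℤ
  𝟘-⊛ H a b n = Σ³-zero a b n

  infixr 7 x^_y^_q^_·_

  x^_y^_q^_·_ : ℕ → ℕ → ℕ → FPS → FPS
  (x^ i y^ j q^ k · H) a b n =
    if i ≤ᵇ a then (if j ≤ᵇ b then (if k ≤ᵇ n then H (a ∸ i) (b ∸ j) (n ∸ k) else 0ℤ) else 0ℤ) else 0ℤ

  mono-⊛ : ∀ c i j k H a b n → (mono c i j k ⊛ H) a b n ≡ c * (x^ i y^ j q^ k · H) a b n
  mono-⊛ c i j k H a b n = begin
      Σ³ a b n (λ x y z → mono c i j k x y z * H (a ∸ x) (b ∸ y) (n ∸ z))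
    ≡⟨ Σ³-cong a b n (λ x y z → split-mono x y z) ⟩
      Σ≤ a (λ x → Σ≤ b (λ y → Σ≤ n (λ z → if i ≡ᵇ x then (if j ≡ᵇ y then (if k ≡ᵇ z then c * H (a ∸ x) (b ∸ y) (n ∸ z) else 0ℤ) else 0ℤ) else 0ℤ)))
    ≡⟨ Σ≤-cong a (λ x → Σ≤-cong b (λ y → trans (Σ≤-if (i ≡ᵇ x) n _) (cong (λ s → if i ≡ᵇ x then s else 0ℤ)
         (trans (Σ≤-if (j ≡ᵇ y) n _) (cong (λ s → if j ≡ᵇ y then s else 0ℤ) (Σ≤-δ n k (λ z → c * H (a ∸ x) (b ∸ y) (n ∸ z)))))))) ⟩
      Σ≤ a (λ x → Σ≤ b (λ y → if i ≡ᵇ x then (if j ≡ᵇ y then (if k ≤ᵇ n then c * H (a ∸ x) (b ∸ y) (n ∸ k) else 0ℤ) else 0ℤ) else 0ℤ))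
    ≡⟨ Σ≤-cong a (λ x → trans (Σ≤-if (i ≡ᵇ x) b _)
         (cong (λ s → if i ≡ᵇ x then s else 0ℤ) (Σ≤-δ b j (λ y → if k ≤ᵇ n then c * H (a ∸ x) (b ∸ y) (n ∸ k) else 0ℤ)))) ⟩
      Σ≤ a (λ x → if i ≡ᵇ x then (if j ≤ᵇ b then (if k ≤ᵇ n then c * H (a ∸ x) (b ∸ j) (n ∸ k) else 0ℤ) else 0ℤ) else 0ℤ)
    ≡⟨ Σ≤-δ a i (λ x → if j ≤ᵇ b then (if k ≤ᵇ n then c * H (a ∸ x) (b ∸ j) (n ∸ k) else 0ℤ) else 0ℤ) ⟩
      (if i ≤ᵇ a then (if j ≤ᵇ b then (if k ≤ᵇ n then c * H (a ∸ i) (b ∸ j) (n ∸ k) else 0ℤ) else 0ℤ) else 0ℤ)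
    ≡⟨ pull-out (i ≤ᵇ a) (j ≤ᵇ b) (k ≤ᵇ n) ⟩
      c * (x^ i y^ j q^ k · H) a b n
    ∎
    where
    open ≡-Reasoning
    split-mono : ∀ x y z → mono c i j k x y z * H (a ∸ x) (b ∸ y) (n ∸ z)
               ≡ (if i ≡ᵇ x then (if j ≡ᵇ y then (if k ≡ᵇ z then c * H (a ∸ x) (b ∸ y) (n ∸ z) else 0ℤ) else 0ℤ) else 0ℤ)
    split-mono x y z with i ≡ᵇ x | j ≡ᵇ y | k ≡ᵇ z
    ... | true  | true  | true  = refl
    ... | true  | true  | false = refl
    ... | true  | false | _     = refl
    ... | false | _     | _     = refl
    v = H (a ∸ i) (b ∸ j) (n ∸ k)
    pull-out : ∀ A B C → (if A then (if B then (if C then c * v else 0ℤ) else 0ℤ) else 0ℤ)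
                       ≡ c * (if A then (if B then (if C then v else 0ℤ) else 0ℤ) else 0ℤ)
    pull-out true  true  true  = refl
    pull-out true  true  false = sym (ℤP.*-zeroʳ c)
    pull-out true  false C     = sym (ℤP.*-zeroʳ c)
    pull-out false B     C     = sym (ℤP.*-zeroʳ c)

module LinearCombinations {X : Set} (_≟_ : DecidableEquality X) where

  open import Data.Nat using (zero; suc)
  open import Data.Integer using (ℤ; +_; -[1+_]; 0ℤ; -_; _+_; _*_)
  import Data.Integer.Properties as ℤP
  open import Data.Bool using (Bool; true; false)
  open import Data.Product using (_×_; _,_)
  open import Data.List using (List; []; _∷_; _++_)
  open import Relation.Binary.PropositionalEquality
  open import Relation.Nullary using (yes; no)
  open import Data.Integer.Tactic.RingSolver using (solve-∀)

  LinComb : Set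
  LinComb = List (ℤ × X)

  eval : (X → ℤ) → LinComb → ℤ
  eval v []            = 0ℤ
  eval v ((c , x) ∷ l) = c * v x + eval v l

  negate : LinComb → LinComb
  negate []             = []
  negate ((c , x) ∷ l) = (- c , x) ∷ negate l

  eval-++ : ∀ v l l' → eval v (l ++ l') ≡ eval v l + eval v l'
  eval-++ v []             l' = sym (ℤP.+-identityˡ _)
  eval-++ v ((c , x) ∷ l) l' rewrite eval-++ v l l' = sym (ℤP.+-assoc (c * v x) (eval v l) (eval v l'))

  eval-negate : ∀ v l → eval v (negate l) ≡ - eval v l
  eval-negate v []             = refl
  eval-negate v ((c , x) ∷ l) rewrite eval-negate v l = distrib c (v x) (eval v l)
    where
    distrib : ∀ c w r → - c * w + - r ≡ - (c * w + r)
    distrib = solve-∀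

  insert : ℤ × X → LinComb → LinComb
  insert e             []             = e ∷ []
  insert (c , x) ((d , y) ∷ l) with x ≟ y
  ... | yes _ = (c + d , y) ∷ l
  ... | no  _ = (d , y) ∷ insert (c , x) l

  eval-insert : ∀ v c x l → eval v (insert (c , x) l) ≡ c * v x + eval v l
  eval-insert v c x []             = refl
  eval-insert v c x ((d , y) ∷ l) with x ≟ y
  ... | yes refl = merge c d (v x) (eval v l)
    where
    merge : ∀ c d w r → (c + d) * w + r ≡ c * w + (d * w + r)
    merge = solve-∀
  ... | no  _ rewrite eval-insert v c x l = swap (d * v y) (c * v x) (eval v l)
    where
    swap : ∀ p q r → p + (q + r) ≡ q + (p + r)
    swap = solve-∀

  collect : LinComb → LinComb
  collect []             = []
  collect ((c , x) ∷ l) = insert (c , x) (collect l)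

  eval-collect : ∀ v l → eval v (collect l) ≡ eval v l
  eval-collect v []             = refl
  eval-collect v ((c , x) ∷ l) rewrite eval-insert v c x (collect l) | eval-collect v l = refl

  allZero : LinComb → Bool
  allZero []                 = true
  allZero ((+ zero , _) ∷ l) = allZero l
  allZero ((_      , _) ∷ l) = false

  eval-allZero : ∀ v l → allZero l ≡ true → eval v l ≡ 0ℤ
  eval-allZero v []                    _ = refl
  eval-allZero v ((+ zero   , x) ∷ l) z = trans (ℤP.+-identityˡ (eval v l)) (eval-allZero v l z)
  eval-allZero v ((+ suc _  , x) ∷ l) ()
  eval-allZero v ((-[1+ _ ] , x) ∷ l) ()

  vanishes : LinComb → Bool
  vanishes l = allZero (collect l)

  eval-vanishes : ∀ v l → vanishes l ≡ true → eval v l ≡ 0ℤ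
  eval-vanishes v l z = trans (sym (eval-collect v l)) (eval-allZero v (collect l) z)

module Certificate where

  open Arithmetic
  open Gaps
  open Counting
  open Enumeration using (countS≡countFrom1)
  open Convolution
  open import Data.Nat using (ℕ; suc; _∸_; _≤ᵇ_; _≟_) renaming (_+_ to _+ℕ_; _*_ to _*ℕ_)
  open import Data.Integer using (ℤ; +_; 0ℤ; -_; _+_; _*_; _-_)
  import Data.Integer.Properties as ℤP
  open import Data.Bool using (true; false; if_then_else_)
  open import Data.Product using (_×_; _,_)
  open import Data.Product.Properties using (≡-dec)
  open import Data.List using (List; []; _∷_; _++_)
  open import Relation.Binary.PropositionalEquality
  open import Data.Integer.Tactic.RingSolver using (solve-∀)

  A₁≡countFrom1 : ∀ a b n → A₁ a b n ≡ + countFrom 1 a b n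
  A₁≡countFrom1 a b n = cong +_ (countS≡countFrom1 a b n)

  substXq-A₁ : ∀ t a b n → substXq (t *ℕ 6) A₁ a b n ≡ + countFrom (suc (t *ℕ 6)) a b n
  substXq-A₁ t a b n rewrite countFrom-shift t a b n with t *ℕ 6 *ℕ a ≤ᵇ n
  ... | true  = A₁≡countFrom1 a b (n ∸ t *ℕ 6 *ℕ a)
  ... | false = refl

  -- (i , j , k , m) stands for the series x^i y^j q^k · countFrom m
  Atom : Set
  Atom = ℕ × ℕ × ℕ × ℕ

  _≟ᵃ_ : DecidableEquality Atom
  _≟ᵃ_ = ≡-dec _≟_ (≡-dec _≟_ (≡-dec _≟_ _≟_))

  atom : Atom → ℕ → ℕ → ℕ → ℕ
  atom (i , j , k , m) a b n = if i ≤ᵇ a then (y^ j q^ k · countFrom m (a ∸ i)) b n else 0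

  smallestPartAtom : ℕ → ℕ → ℕ → ℕ → Atom
  smallestPartAtom i j k m = (suc i , j +ℕ evenness (suc m) , k +ℕ suc m , suc m +ℕ gap (suc m))

  atom-suc : ∀ i j k m a b n →
    atom (i , j , k , suc m) a b n
    ≡ atom (i , j , k , suc (suc m)) a b n +ℕ atom (smallestPartAtom i j k m) a b n
  atom-suc i j k m a b n = begin
      (if i ≤ᵇ a then (y^ j q^ k · countFrom (suc m) (a ∸ i)) b n else 0)
    ≡⟨ cong (λ x → if i ≤ᵇ a then x else 0)
         (trans (y^q^-cong j k (countFrom (suc m) (a ∸ i)) (λ b n → countFrom (suc (suc m)) (a ∸ i) b n +ℕ smallestPart (suc m) (a ∸ i) b n) b n
                           (λ b' → countFrom-suc m (a ∸ i) b' (n ∸ k)))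
                (y^q^-+ j k (countFrom (suc (suc m)) (a ∸ i)) (smallestPart (suc m) (a ∸ i)) b n)) ⟩
      (if i ≤ᵇ a then (y^ j q^ k · countFrom (suc (suc m)) (a ∸ i)) b n +ℕ (y^ j q^ k · smallestPart (suc m) (a ∸ i)) b n else 0)
    ≡⟨ if-+ (i ≤ᵇ a) _ _ ⟩
      atom (i , j , k , suc (suc m)) a b n +ℕ (if i ≤ᵇ a then (y^ j q^ k · smallestPart (suc m) (a ∸ i)) b n else 0)
    ≡⟨ cong (atom (i , j , k , suc (suc m)) a b n +ℕ_)
         (guard-suc i a (λ a' → (y^ j q^ k · smallestPart (suc m) a') b n)
                        (λ a' → (y^ j +ℕ evenness (suc m) q^ k +ℕ suc m · countFrom (suc m +ℕ gap (suc m)) a') b n)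
                        (y^q^-0 j k b n)
                        (λ a' → y^q^-comp j k (evenness (suc m)) (suc m) (countFrom (suc m +ℕ gap (suc m)) a') b n)) ⟩
      atom (i , j , k , suc (suc m)) a b n +ℕ atom (smallestPartAtom i j k m) a b n
    ∎
    where open ≡-Reasoning

  open LinearCombinations _≟ᵃ_

  value : ℕ → ℕ → ℕ → Atom → ℤ
  value a b n x = + atom x a b n

  -- (c , i , j , k , m) stands for c x^i y^j q^k times the recurrence countFrom-suc m, which expresses B_{m+1}
  Instance : Set
  Instance = ℤ × ℕ × ℕ × ℕ × ℕ

  recurrence : Instance → LinComb
  recurrence (c , i , j , k , m) =
    (c , (i , j , k , suc m)) ∷ (- c , (i , j , k , suc (suc m))) ∷
    (- c , smallestPartAtom i j k m) ∷ []

  recurrences : List Instance → LinComb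
  recurrences []       = []
  recurrences (r ∷ rs) = recurrence r ++ recurrences rs

  eval-recurrences : ∀ a b n rs → eval (value a b n) (recurrences rs) ≡ 0ℤ
  eval-recurrences a b n []                         = refl
  eval-recurrences a b n ((c , i , j , k , m) ∷ rs)
    rewrite eval-++ (value a b n) (recurrence (c , i , j , k , m)) (recurrences rs)
          | atom-suc i j k m a b n
          | ℤP.pos-+ (atom (i , j , k , suc (suc m)) a b n) (atom (smallestPartAtom i j k m) a b n)
          | eval-recurrences a b n rs
    = cancel c _ _
    where
    cancel : ∀ c y z → (c * (y + z) + (- c * y + (- c * z + 0ℤ))) + 0ℤ ≡ 0ℤ
    cancel = solve-∀

  infixl 6 _⊕′_ _⊖′_
  infix  7 _·countFrom_

  data Poly : Set where
    mono′     : ℤ → ℕ → ℕ → ℕ → Poly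
    𝟘′        : Poly
    _⊕′_ _⊖′_ : Poly → Poly → Poly

  ⟦_⟧ : Poly → FPS
  ⟦ mono′ c i j k ⟧ = mono c i j k
  ⟦ 𝟘′ ⟧            = 𝟘
  ⟦ P ⊕′ Q ⟧        = ⟦ P ⟧ ⊕ ⟦ Q ⟧
  ⟦ P ⊖′ Q ⟧        = ⟦ P ⟧ ⊖ ⟦ Q ⟧

  _·countFrom_ : Poly → ℕ → LinComb
  mono′ c i j k ·countFrom m = (c , (i , j , k , m)) ∷ []
  𝟘′            ·countFrom m = []
  (P ⊕′ Q)      ·countFrom m = P ·countFrom m ++ Q ·countFrom m
  (P ⊖′ Q)      ·countFrom m = P ·countFrom m ++ negate (Q ·countFrom m)

  x^y^q^-atom : ∀ i j k m H → (∀ a b n → H a b n ≡ + countFrom m a b n) →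
                ∀ a b n → (x^ i y^ j q^ k · H) a b n ≡ value a b n (i , j , k , m)
  x^y^q^-atom i j k m H H≡ a b n with i ≤ᵇ a | j ≤ᵇ b | k ≤ᵇ n
  ... | true  | true  | true  = H≡ _ _ _
  ... | true  | true  | false = refl
  ... | true  | false | true  = refl
  ... | true  | false | false = refl
  ... | false | _     | _     = refl

  ⊛-atoms : ∀ P m H → (∀ a b n → H a b n ≡ + countFrom m a b n) →
            ∀ a b n → (⟦ P ⟧ ⊛ H) a b n ≡ eval (value a b n) (P ·countFrom m)
  ⊛-atoms (mono′ c i j k) m H H≡ a b n =
    trans (mono-⊛ c i j k H a b n) (trans (cong (c *_) (x^y^q^-atom i j k m H H≡ a b n)) (sym (ℤP.+-identityʳ _)))
  ⊛-atoms 𝟘′ m H H≡ a b n = 𝟘-⊛ H a b n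
  ⊛-atoms (P ⊕′ Q) m H H≡ a b n =
    trans (⊛-distribʳ-⊕ ⟦ P ⟧ ⟦ Q ⟧ H a b n)
          (trans (cong₂ _+_ (⊛-atoms P m H H≡ a b n) (⊛-atoms Q m H H≡ a b n))
                 (sym (eval-++ (value a b n) (P ·countFrom m) (Q ·countFrom m))))
  ⊛-atoms (P ⊖′ Q) m H H≡ a b n =
    trans (⊛-distribʳ-⊖ ⟦ P ⟧ ⟦ Q ⟧ H a b n)
          (trans (cong₂ _-_ (⊛-atoms P m H H≡ a b n) (⊛-atoms Q m H H≡ a b n))
                 (trans (cong (_+_ (eval (value a b n) (P ·countFrom m))) (sym (eval-negate (value a b n) (Q ·countFrom m))))
                        (sym (eval-++ (value a b n) (P ·countFrom m) (negate (Q ·countFrom m))))))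

  certified-identity : ∀ (P₁ P₂ P₃ : Poly) (rs : List Instance) →
    vanishes (P₁ ·countFrom 1 ++ negate (P₂ ·countFrom 7) ++ P₃ ·countFrom 13 ++ negate (recurrences rs)) ≡ true →
    ∀ a b n → (⟦ P₁ ⟧ ⊛ A₁ ⊖ ⟦ P₂ ⟧ ⊛ substXq 6 A₁ ⊕ ⟦ P₃ ⟧ ⊛ substXq 12 A₁) a b n ≡ 0ℤ
  certified-identity P₁ P₂ P₃ rs ok a b n = begin
      (⟦ P₁ ⟧ ⊛ A₁) a b n - (⟦ P₂ ⟧ ⊛ substXq 6 A₁) a b n + (⟦ P₃ ⟧ ⊛ substXq 12 A₁) a b n
    ≡⟨ cong₂ _+_ (cong₂ _-_ (⊛-atoms P₁ 1 A₁ A₁≡countFrom1 a b n) (⊛-atoms P₂ 7 (substXq 6 A₁) (substXq-A₁ 1) a b n))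
                 (⊛-atoms P₃ 13 (substXq 12 A₁) (substXq-A₁ 2) a b n) ⟩
      eval v l₁ - eval v l₂ + eval v l₃
    ≡⟨ rearrange (eval v l₁) (eval v l₂) (eval v l₃) (eval v lᵣ) ⟩
      (eval v l₁ + (- eval v l₂ + (eval v l₃ + - eval v lᵣ))) + eval v lᵣ
    ≡⟨ cong₂ _+_ (sym eval-whole) (eval-recurrences a b n rs) ⟩
      eval v (l₁ ++ negate l₂ ++ l₃ ++ negate lᵣ) + 0ℤ
    ≡⟨ cong (_+ 0ℤ) (eval-vanishes v (l₁ ++ negate l₂ ++ l₃ ++ negate lᵣ) ok) ⟩
      0ℤ
    ∎
    where
    open ≡-Reasoning
    v  = value a b n
    l₁ = P₁ ·countFrom 1
    l₂ = P₂ ·countFrom 7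
    l₃ = P₃ ·countFrom 13
    lᵣ = recurrences rs
    rearrange : ∀ e₁ e₂ e₃ r → e₁ - e₂ + e₃ ≡ (e₁ + (- e₂ + (e₃ + - r))) + r
    rearrange = solve-∀
    eval-whole : eval v (l₁ ++ negate l₂ ++ l₃ ++ negate lᵣ) ≡ eval v l₁ + (- eval v l₂ + (eval v l₃ + - eval v lᵣ))
    eval-whole rewrite eval-++ v l₁ (negate l₂ ++ l₃ ++ negate lᵣ) | eval-++ v (negate l₂) (l₃ ++ negate lᵣ)
                     | eval-++ v l₃ (negate lᵣ) | eval-negate v l₂ | eval-negate v lᵣ = refl

open import Data.Integer using (+_; -[1+_])
open import Data.List using (List; []; _∷_)
open import Data.Product using (_,_)
open import Relation.Binary.PropositionalEquality using (refl)
open Certificate using (Poly; mono′; 𝟘′; _⊕′_; _⊖′_; Instance; certified-identity)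

-- P₁, P₂, P₃ restate the coefficients of the theorem in a syntax whose ⟦_⟧ is definitionally the
-- corresponding series of Defs.
𝕞′ 𝕞₂′ : ℕ → ℕ → ℕ → Poly
𝕞′  = mono′ (+ 1)
𝕞₂′ = mono′ (+ 2)

P₁ P₂ P₃ : Poly
P₁ = 𝕞′ 0 0 0 ⊕′ 𝕞′ 1 0 7 ⊕′ 𝕞′ 1 1 8
P₂ = 𝕞′ 0 0 0
     ⊕′ (𝕞′ 1 0 1 ⊕′ 𝕞′ 1 0 3 ⊕′ 𝕞′ 1 0 5 ⊕′ 𝕞′ 1 0 7 ⊕′ 𝕞′ 1 1 2 ⊕′ 𝕞′ 1 1 4 ⊕′ 𝕞′ 1 1 6 ⊕′ 𝕞′ 1 1 8)
     ⊕′ (𝕞′ 2 0 6 ⊕′ 𝕞′ 2 0 8 ⊕′ 𝕞′ 2 0 10 ⊕′ 𝕞′ 2 1 5 ⊕′ 𝕞₂′ 2 1 7 ⊕′ 𝕞₂′ 2 1 9 ⊕′ 𝕞₂′ 2 1 11 ⊕′ 𝕞′ 2 1 13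
         ⊕′ 𝕞′ 2 2 8 ⊕′ 𝕞′ 2 2 10 ⊕′ 𝕞′ 2 2 12)
     ⊕′ (𝕞′ 3 1 12 ⊕′ 𝕞′ 3 1 14 ⊕′ 𝕞′ 3 2 13 ⊕′ 𝕞′ 3 2 15)
P₃ = 𝕞′ 2 1 15
     ⊕′ (𝟘′ ⊖′ 𝕞′ 3 0 21 ⊕′ 𝕞′ 3 1 16 ⊕′ 𝕞′ 3 2 17 ⊖′ 𝕞′ 3 3 24)
     ⊕′ (𝟘′ ⊖′ 𝕞′ 4 0 22 ⊖′ 𝕞′ 4 1 23 ⊕′ 𝕞′ 4 2 30 ⊖′ 𝕞′ 4 3 25 ⊖′ 𝕞′ 4 4 26)
     ⊕′ (𝕞′ 5 2 31 ⊕′ 𝕞′ 5 3 32)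

certificate : List Instance
certificate =
  (+ 1 , 0 , 0 , 0 , 0) ∷ (+ 1 , 1 , 0 , 7 , 0) ∷ (+ 1 , 1 , 1 , 8 , 0) ∷
  (+ 1 , 0 , 0 , 0 , 1) ∷ (+ 1 , 1 , 0 , 7 , 1) ∷ (+ 1 , 1 , 1 , 8 , 1) ∷
  (+ 1 , 0 , 0 , 0 , 2) ∷ (+ 1 , 1 , 0 , 7 , 2) ∷ (+ 1 , 1 , 1 , 8 , 2) ∷
  (+ 1 , 0 , 0 , 0 , 3) ∷ (+ 1 , 1 , 0 , 1 , 3) ∷ (+ 1 , 1 , 0 , 7 , 3) ∷ (+ 1 , 1 , 1 , 8 , 3) ∷
  (+ 1 , 2 , 0 , 8 , 3) ∷ (+ 1 , 2 , 1 , 9 , 3) ∷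
  (+ 1 , 0 , 0 , 0 , 4) ∷ (+ 1 , 1 , 0 , 1 , 4) ∷ (+ 1 , 1 , 0 , 7 , 4) ∷ (+ 1 , 1 , 1 , 2 , 4) ∷
  (+ 1 , 1 , 1 , 8 , 4) ∷ (+ 1 , 2 , 0 , 8 , 4) ∷ (+ 2 , 2 , 1 , 9 , 4) ∷ (+ 1 , 2 , 2 , 10 , 4) ∷
  (+ 1 , 0 , 0 , 0 , 5) ∷ (+ 1 , 1 , 0 , 1 , 5) ∷ (+ 1 , 1 , 0 , 7 , 5) ∷ (+ 1 , 1 , 1 , 2 , 5) ∷
  (+ 1 , 1 , 1 , 8 , 5) ∷ (+ 1 , 2 , 0 , 8 , 5) ∷ (+ 2 , 2 , 1 , 9 , 5) ∷ (+ 1 , 2 , 2 , 10 , 5) ∷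
  (-[1+ 0 ] , 1 , 0 , 5 , 6) ∷ (-[1+ 0 ] , 1 , 1 , 6 , 6) ∷ (-[1+ 0 ] , 2 , 0 , 6 , 6) ∷ (-[1+ 1 ] , 2 , 1 , 7 , 6) ∷
  (-[1+ 0 ] , 2 , 1 , 13 , 6) ∷ (-[1+ 0 ] , 2 , 2 , 8 , 6) ∷ (-[1+ 0 ] , 3 , 1 , 14 , 6) ∷ (-[1+ 0 ] , 3 , 2 , 15 , 6) ∷
  (-[1+ 0 ] , 1 , 1 , 6 , 7) ∷ (+ 1 , 2 , 0 , 12 , 7) ∷ (-[1+ 0 ] , 2 , 1 , 7 , 7) ∷ (-[1+ 0 ] , 2 , 2 , 8 , 7) ∷
  (+ 1 , 3 , 0 , 13 , 7) ∷ (+ 1 , 3 , 1 , 14 , 7) ∷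
  (-[1+ 0 ] , 1 , 1 , 6 , 8) ∷ (+ 1 , 2 , 0 , 12 , 8) ∷ (-[1+ 0 ] , 2 , 1 , 7 , 8) ∷ (-[1+ 0 ] , 2 , 2 , 8 , 8) ∷
  (+ 1 , 3 , 0 , 13 , 8) ∷ (+ 1 , 3 , 1 , 14 , 8) ∷
  (+ 1 , 2 , 2 , 14 , 9) ∷ (-[1+ 0 ] , 3 , 1 , 20 , 9) ∷ (+ 1 , 3 , 2 , 15 , 9) ∷ (+ 1 , 3 , 3 , 16 , 9) ∷
  (-[1+ 0 ] , 4 , 1 , 21 , 9) ∷ (-[1+ 0 ] , 4 , 2 , 22 , 9) ∷
  []

mainTheorem3 : ∀ (a b n : ℕ) →
    ( (𝕞 0 0 0 ⊕ 𝕞 1 0 7 ⊕ 𝕞 1 1 8) ⊛ A₁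
      ⊖ ( 𝕞 0 0 0
          ⊕ (𝕞 1 0 1 ⊕ 𝕞 1 0 3 ⊕ 𝕞 1 0 5 ⊕ 𝕞 1 0 7 ⊕ 𝕞 1 1 2 ⊕ 𝕞 1 1 4 ⊕ 𝕞 1 1 6 ⊕ 𝕞 1 1 8)
          ⊕ (𝕞 2 0 6 ⊕ 𝕞 2 0 8 ⊕ 𝕞 2 0 10 ⊕ 𝕞 2 1 5 ⊕ 𝕞₂ 2 1 7 ⊕ 𝕞₂ 2 1 9 ⊕ 𝕞₂ 2 1 11 ⊕ 𝕞 2 1 13
             ⊕ 𝕞 2 2 8 ⊕ 𝕞 2 2 10 ⊕ 𝕞 2 2 12)
          ⊕ (𝕞 3 1 12 ⊕ 𝕞 3 1 14 ⊕ 𝕞 3 2 13 ⊕ 𝕞 3 2 15) ) ⊛ substXq 6 A₁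
      ⊕ ( 𝕞 2 1 15
          ⊕ (𝟘 ⊖ 𝕞 3 0 21 ⊕ 𝕞 3 1 16 ⊕ 𝕞 3 2 17 ⊖ 𝕞 3 3 24)
          ⊕ (𝟘 ⊖ 𝕞 4 0 22 ⊖ 𝕞 4 1 23 ⊕ 𝕞 4 2 30 ⊖ 𝕞 4 3 25 ⊖ 𝕞 4 4 26)
          ⊕ (𝕞 5 2 31 ⊕ 𝕞 5 3 32) ) ⊛ substXq 12 A₁ ) a b n ≡ 0ℤ
mainTheorem3 = certified-identity P₁ P₂ P₃ certificate refl
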